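{- For all positive integers $m\le n$, the number of integers $j$ with $1\le j\le n$ and $\gcd(j,m)=1$ is greater than $\frac{\varphi(m)}{m}\,n-\sqrt{n}$.
   Context: $\varphi$ is Euler's totient function. -}

module Defs where

open import Data.Nat using (ℕ; suc; _*_; _∸_; _^_; _<_)
open import Data.Nat.GCD using (gcd)
open import Data.Nat.Properties using (_≟_)
open import Data.List using (List; length; filter; upTo; map)
open import Relation.Nullary.Decidable using (¬?)

oneTo : ℕ → List ℕ
oneTo n = map suc (upTo n)

coprimeCount : ℕ → ℕ → ℕ
coprimeCount m n = length (filter (λ j → gcd j m ≟ 1) (oneTo n))

φ : ℕ → ℕ
φ m = coprimeCount m m

-- GtFracMinusSqrt c a b n  encodes the real inequality  c > (a / b) - √n
-- for naturals with b ≥ 1, n ≥ 1, without real numbers: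
--   c > a/b - √n  ⟺  b·√n > a - b·c
--                 ⟺  (a ∸ b·c)² < b²·n
-- (if a ≤ b·c the left side is 0 and b·√n > 0 holds; otherwise both sides
-- of b·√n > a - b·c are nonnegative, so one may square).
GtFracMinusSqrt : ℕ → ℕ → ℕ → ℕ → Set
GtFracMinusSqrt c a b n = (a ∸ b * c) ^ 2 < b ^ 2 * n

-- Let M be the product of the distinct primes dividing m and F = φ(M), so that m = d·M and φ(m) = d·F.
-- Adjoining a new prime p to M turns the count c(r) into c(r) − c(⌊r/p⌋); following the error of
-- M·c(r) against F·r through this sieve step gives F·r − A ≤ M·c(r) ≤ F·r + B, where (A + B + M)²
-- grows by a factor of at most 4p² per prime while M³ grows by p³. As 4/p < 1 for p ≥ 5 and the
-- primes 2 and 3 cost at most 8/3 together, A² < M³ ≤ M²·n, and scaling the lower bound by d gives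
-- φ(m)·n − m·c(n) ≤ d·A < m·√n.
module Submission where

open import Defs
open import Data.Nat
open import Data.Nat.Properties
open import Data.Nat.Divisibility
open import Data.Nat.Coprimality using (Coprime; coprime?; coprime-divisor; coprime⇒gcd≡1; gcd≡1⇒coprime)
import Data.Nat.Coprimality as Cop
open import Data.Nat.GCD using (gcd)
open import Data.Nat.DivMod using (_/_; _%_; m≡m%n+[m/n]*n; m%n<n)
open import Data.Nat.Tactic.RingSolver using (solve-∀)
open import Data.Bool using (true; false; if_then_else_)
open import Data.Nat.Primality
open import Data.Nat.Primality.Factorisation using (PrimeFactorisation; factorise)
open import Data.Nat.ListAction using (product)
open import Data.List using ([]; _∷_; _∷ʳ_; _++_; length; filter; upTo; map)
open import Data.List.Properties using (upTo-∷ʳ; map-++; filter-++; length-++; filter-accept; filter-reject; filter-≐; filter-all; length-map; length-upTo)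
open import Data.List.Relation.Unary.All as All using (All; []; _∷_)
open import Data.Product using (_,_; proj₂)
open import Data.Sum using (inj₁; inj₂)
open import Function using (_∘_; flip)
open import Relation.Nullary using (¬_; yes; no; does; contradiction)
open import Relation.Nullary.Decidable using (dec-true; dec-false)
open import Relation.Unary using (Decidable)
open import Relation.Binary.PropositionalEquality

private variable a b d j k m n : ℕ

coprime-* : Coprime j a → Coprime j b → Coprime j (a * b)
coprime-* {j} {a} cj-a cj-b {d} (d∣j , d∣ab) = cj-b (d∣j , coprime-divisor cd-a d∣ab)
  where
  cd-a : Coprime d a
  cd-a (e∣d , e∣a) = cj-a (∣-trans e∣d d∣j , e∣a)

coprime-∣ʳ : d ∣ a → Coprime j a → Coprime j d
coprime-∣ʳ d∣a c (e∣j , e∣d) = c (e∣j , ∣-trans e∣d d∣a)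

coprime-∣ˡ : d ∣ j → Coprime j a → Coprime d a
coprime-∣ˡ d∣j c (e∣d , e∣a) = c (∣-trans e∣d d∣j , e∣a)

coprime-1 : ∀ j → Coprime j 1
coprime-1 j = ∣1⇒≡1 ∘ proj₂

prime-∤⇒coprime : ∀ {p} → Prime p → ¬ p ∣ j → Coprime j p
prime-∤⇒coprime pr p∤j {d} (d∣j , d∣p) with prime⇒irreducible pr d∣p
... | inj₁ d≡1 = d≡1
... | inj₂ d≡p = contradiction (subst (_∣ _) d≡p d∣j) p∤j

prime-∣⇒¬coprime : ∀ {p} → Prime p → p ∣ j → ¬ Coprime j p
prime-∣⇒¬coprime {p = p} pr p∣j c = <⇒≢ (nonTrivial⇒n>1 p {{prime⇒nonTrivial pr}}) (sym (c (p∣j , ∣-refl)))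

coprime-*-prime : ∀ {p} → Prime p → ¬ p ∣ j → Coprime j k → Coprime j (p * k)
coprime-*-prime pr p∤j = coprime-* (prime-∤⇒coprime pr p∤j)

coprimeTo? : (m : ℕ) → Decidable (λ j → gcd j m ≡ 1)
coprimeTo? m j = gcd j m ≟ 1

coprimeCount-suc : ∀ m n → coprimeCount m (suc n) ≡ coprimeCount m n + length (filter (coprimeTo? m) (suc n ∷ []))
coprimeCount-suc m n = begin
  length (filter (coprimeTo? m) (map suc (upTo (suc n))))
    ≡⟨ cong (length ∘ filter (coprimeTo? m) ∘ map suc) (upTo-∷ʳ n) ⟨
  length (filter (coprimeTo? m) (map suc (upTo n ∷ʳ n)))
    ≡⟨ cong (length ∘ filter (coprimeTo? m)) (map-++ suc (upTo n) (n ∷ [])) ⟩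
  length (filter (coprimeTo? m) (oneTo n ∷ʳ suc n))
    ≡⟨ cong length (filter-++ (coprimeTo? m) (oneTo n) (suc n ∷ [])) ⟩
  length (filter (coprimeTo? m) (oneTo n) ++ filter (coprimeTo? m) (suc n ∷ []))
    ≡⟨ length-++ (filter (coprimeTo? m) (oneTo n)) ⟩
  coprimeCount m n + length (filter (coprimeTo? m) (suc n ∷ [])) ∎
  where open ≡-Reasoning

coprimeCount-suc-coprime : Coprime (suc n) m → coprimeCount m (suc n) ≡ suc (coprimeCount m n)
coprimeCount-suc-coprime {n} {m} c = begin
  coprimeCount m (suc n)                                             ≡⟨ coprimeCount-suc m n ⟩
  coprimeCount m n + length (filter (coprimeTo? m) (suc n ∷ []))     ≡⟨ cong (λ l → coprimeCount m n + length l) (filter-accept (coprimeTo? m) {suc n} {[]} (coprime⇒gcd≡1 c)) ⟩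
  coprimeCount m n + 1                                               ≡⟨ +-comm _ 1 ⟩
  suc (coprimeCount m n)                                             ∎
  where open ≡-Reasoning

coprimeCount-suc-¬coprime : ¬ Coprime (suc n) m → coprimeCount m (suc n) ≡ coprimeCount m n
coprimeCount-suc-¬coprime {n} {m} ¬c = begin
  coprimeCount m (suc n)                                             ≡⟨ coprimeCount-suc m n ⟩
  coprimeCount m n + length (filter (coprimeTo? m) (suc n ∷ []))     ≡⟨ cong (λ l → coprimeCount m n + length l) (filter-reject (coprimeTo? m) {suc n} {[]} (¬c ∘ gcd≡1⇒coprime)) ⟩
  coprimeCount m n + 0                                               ≡⟨ +-identityʳ _ ⟩
  coprimeCount m n                                                   ∎
  where open ≡-Reasoning

coprimeCount-cong : (∀ {j} → Coprime j m → Coprime j k) → (∀ {j} → Coprime j k → Coprime j m) →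
                    ∀ n → coprimeCount m n ≡ coprimeCount k n
coprimeCount-cong {m} {k} to from n =
  cong length (filter-≐ (coprimeTo? m) (coprimeTo? k)
    ((λ {j} → coprime⇒gcd≡1 ∘ to {j} ∘ gcd≡1⇒coprime) , (λ {j} → coprime⇒gcd≡1 ∘ from {j} ∘ gcd≡1⇒coprime)) (oneTo n))

coprimeCount-1 : ∀ n → coprimeCount 1 n ≡ n
coprimeCount-1 n = begin
  length (filter (coprimeTo? 1) (oneTo n))  ≡⟨ cong length (filter-all (coprimeTo? 1) {oneTo n} (All.tabulate λ {j} _ → coprime⇒gcd≡1 (coprime-1 j))) ⟩
  length (map suc (upTo n))                 ≡⟨ length-map suc (upTo n) ⟩
  length (upTo n)                           ≡⟨ length-upTo n ⟩
  n                                         ∎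
  where open ≡-Reasoning

coprimeCount-*-∣ : ∀ {p} → p ∣ k → ∀ n → coprimeCount (p * k) n ≡ coprimeCount k n
coprimeCount-*-∣ {p = p} p∣k = coprimeCount-cong (coprime-∣ʳ (n∣m*n p)) (λ c → coprime-* (coprime-∣ʳ p∣k c) c)

-- Count along r = t + q·p, a form in which both steps r ↦ r + 1 are definitional: an integer not
-- divisible by p is coprime to p·k iff it is coprime to k, while (q + 1)·p is never coprime to p·k
-- and is coprime to k iff q + 1 is.
coprimeCount-*-∤ : ∀ {p} → Prime p → ¬ p ∣ k → ∀ q t → t < p →
                   coprimeCount (p * k) (t + q * p) + coprimeCount k q ≡ coprimeCount k (t + q * p)
coprimeCount-*-∤ {k = k} {p = p@(suc p′)} pr p∤k = go
  where
  ∤-residue : ∀ q {t} → suc t < p → ¬ p ∣ suc t + q * p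
  ∤-residue q 1+t<p p∣ = <⇒≱ 1+t<p (∣⇒≤ (∣m+n∣m⇒∣n (subst (p ∣_) (+-comm (suc _) (q * p)) p∣) (n∣m*n q)))

  go : ∀ q t → t < p → coprimeCount (p * k) (t + q * p) + coprimeCount k q ≡ coprimeCount k (t + q * p)
  go zero    zero    _ = refl
  go q       (suc t) (s≤s t<p′) with coprime? (suc (t + q * p)) k
  ... | yes c rewrite coprimeCount-suc-coprime c | coprimeCount-suc-coprime (coprime-*-prime pr (∤-residue q (s≤s t<p′)) c) =
    cong suc (go q t (m<n⇒m<1+n t<p′))
  ... | no ¬c rewrite coprimeCount-suc-¬coprime ¬c | coprimeCount-suc-¬coprime (¬c ∘ coprime-∣ʳ (n∣m*n p)) =
    go q t (m<n⇒m<1+n t<p′)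
  go (suc q) zero    _
    rewrite coprimeCount-suc-¬coprime (prime-∣⇒¬coprime pr (n∣m*n (suc q)) ∘ coprime-∣ʳ (m∣m*n k))
    with coprime? (suc q) k
  ... | yes c rewrite coprimeCount-suc-coprime c | coprimeCount-suc-coprime (Cop.sym (coprime-* (Cop.sym c) (prime-∤⇒coprime pr p∤k))) =
    trans (+-suc _ _) (cong suc (go q p′ ≤-refl))
  ... | no ¬c rewrite coprimeCount-suc-¬coprime ¬c | coprimeCount-suc-¬coprime (¬c ∘ coprime-∣ˡ (m∣m*n p)) =
    go q p′ ≤-refl

record LinearBounds (c : ℕ → ℕ) (M F A B : ℕ) : Set where
  field
    upper : ∀ r → M * c r ≤ F * r + B
    lower : ∀ r → F * r ≤ M * c r + A

-- With r = t + q·p and t < p:  p·M·c′(r) − (p − 1)·F·r = p·(M·c(r) − F·r) − p·(M·c(q) − F·q) + F·t.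
linearBounds-sieve : ∀ {c c′ : ℕ → ℕ} {M F A B} p′ →
  (∀ q t → t < suc p′ → c′ (t + q * suc p′) + c q ≡ c (t + q * suc p′)) →
  LinearBounds c M F A B →
  LinearBounds c′ (suc p′ * M) (p′ * F) (suc p′ * (A + B)) (suc p′ * (A + B + F))
linearBounds-sieve {c} {c′} {M} {F} {A} {B} p′ split bounds = record
  { upper = λ r → subst (λ r → p * M * c′ r ≤ p′ * F * r + p * (A + B + F)) (sym (quotRem r)) (upper′ (r / p) (r % p) (m%n<n r p))
  ; lower = λ r → subst (λ r → p′ * F * r ≤ p * M * c′ r + p * (A + B)) (sym (quotRem r)) (lower′ (r / p) (r % p) (m%n<n r p))
  }
  where
  open LinearBounds bounds
  open ≤-Reasoning
  p : ℕ
  p = suc p′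

  quotRem : ∀ r → r ≡ r % p + r / p * p
  quotRem r = m≡m%n+[m/n]*n r p

  upper′ : ∀ q t → t < p → p * M * c′ (t + q * p) ≤ p′ * F * (t + q * p) + p * (A + B + F)
  upper′ q t t<p = +-cancelʳ-≤ (p * M * c q) _ _ (begin
    p * M * c′ r + p * M * c q                    ≡⟨ *-distribˡ-+ (p * M) (c′ r) (c q) ⟨
    p * M * (c′ r + c q)                          ≡⟨ cong (p * M *_) (split q t t<p) ⟩
    p * M * c r                                   ≡⟨ *-assoc p M (c r) ⟩
    p * (M * c r)                                 ≤⟨ *-monoʳ-≤ p (upper r) ⟩
    p * (F * r + B)                               ≡⟨ expand p′ F B q t ⟩
    p′ * F * r + F * t + p * (F * q) + p * B      ≤⟨ +-monoˡ-≤ (p * B) (+-mono-≤ (+-monoʳ-≤ (p′ * F * r) (*-monoʳ-≤ F (<⇒≤ t<p))) (*-monoʳ-≤ p (lower q))) ⟩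
    p′ * F * r + F * p + p * (M * c q + A) + p * B ≡⟨ collect p′ F M A B (c q) r ⟩
    p′ * F * r + p * (A + B + F) + p * M * c q    ∎)
    where
    r : ℕ
    r = t + q * p
    expand : ∀ p′ F B q t → suc p′ * (F * (t + q * suc p′) + B) ≡ p′ * F * (t + q * suc p′) + F * t + suc p′ * (F * q) + suc p′ * B
    expand = solve-∀
    collect : ∀ p′ F M A B Y r → p′ * F * r + F * suc p′ + suc p′ * (M * Y + A) + suc p′ * B ≡ p′ * F * r + suc p′ * (A + B + F) + suc p′ * M * Y
    collect = solve-∀

  lower′ : ∀ q t → t < p → p′ * F * (t + q * p) ≤ p * M * c′ (t + q * p) + p * (A + B)
  lower′ q t t<p = +-cancelʳ-≤ (p * M * c q) _ _ (begin
    p′ * F * r + p * M * c q                      ≡⟨ cong (p′ * F * r +_) (*-assoc p M (c q)) ⟩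
    p′ * F * r + p * (M * c q)                    ≤⟨ +-monoʳ-≤ (p′ * F * r) (*-monoʳ-≤ p (upper q)) ⟩
    p′ * F * r + p * (F * q + B)                  ≡⟨ expand p′ F B q r ⟩
    p′ * F * r + F * (q * p) + p * B              ≤⟨ +-monoˡ-≤ (p * B) (+-monoʳ-≤ (p′ * F * r) (*-monoʳ-≤ F (m≤n+m (q * p) t))) ⟩
    p′ * F * r + F * r + p * B                    ≡⟨ gather p′ F B r ⟩
    p * (F * r) + p * B                           ≤⟨ +-monoˡ-≤ (p * B) (*-monoʳ-≤ p (lower r)) ⟩
    p * (M * c r + A) + p * B                     ≡⟨ cong (λ z → p * (M * z + A) + p * B) (split q t t<p) ⟨
    p * (M * (c′ r + c q) + A) + p * B            ≡⟨ distribute p′ M A B (c′ r) (c q) ⟩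
    p * M * c′ r + p * (A + B) + p * M * c q      ∎)
    where
    r : ℕ
    r = t + q * p
    expand : ∀ p′ F B q r → p′ * F * r + suc p′ * (F * q + B) ≡ p′ * F * r + F * (q * suc p′) + suc p′ * B
    expand = solve-∀
    gather : ∀ p′ F B r → p′ * F * r + F * r + suc p′ * B ≡ suc p′ * (F * r) + suc p′ * B
    gather = solve-∀
    distribute : ∀ p′ M A B X Y → suc p′ * (M * (X + Y) + A) + suc p′ * B ≡ suc p′ * M * X + suc p′ * (A + B) + suc p′ * M * Y
    distribute = solve-∀

ifDivides : (d M hi lo : ℕ) → ℕ
ifDivides d M hi lo = if does (d ∣? M) then hi else lo

-- weight M / 3 bounds the product of 4/p over the primes p ∣ M, the factor by which
-- (A + B + M)² / M³ may grow; only p = 2 and p = 3 have 4/p > 1.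
weight : ℕ → ℕ
weight M = ifDivides 2 M 2 1 * ifDivides 3 M 4 3

ifDivides-≤ : ∀ d M {hi lo} → lo ≤ hi → ifDivides d M hi lo ≤ hi
ifDivides-≤ d M lo≤hi with does (d ∣? M)
... | true  = ≤-refl
... | false = lo≤hi

ifDivides-mono : ∀ d M N {hi lo} → lo ≤ hi → (d ∣ M → d ∣ N) → ifDivides d M hi lo ≤ ifDivides d N hi lo
ifDivides-mono d M N lo≤hi M⇒N with d ∣? M | d ∣? N
... | yes d∣M | no d∤N  = contradiction (M⇒N d∣M) d∤N
... | yes _   | yes _   = ≤-refl
... | no _    | yes _   = lo≤hi
... | no _    | no _    = ≤-refl

weight≤8 : ∀ M → weight M ≤ 8
weight≤8 M = *-mono-≤ (ifDivides-≤ 2 M (s≤s z≤n)) (ifDivides-≤ 3 M (s≤s (s≤s (s≤s z≤n))))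

weight-step : ∀ p M → 2 ≤ p → ¬ p ∣ M → 4 * weight M ≤ p * weight (p * M)
weight-step 1 M (s≤s ()) _
weight-step 2 M _ 2∤M
  rewrite dec-false (2 ∣? M) 2∤M | dec-true (2 ∣? (2 * M)) (m∣m*n M) =
  subst₂ _≤_ (eqˡ (ifDivides 3 M 4 3)) (eqʳ (ifDivides 3 (2 * M) 4 3))
    (*-monoʳ-≤ 4 (ifDivides-mono 3 M (2 * M) (s≤s (s≤s (s≤s z≤n))) (∣n⇒∣m*n 2)))
  where
  eqˡ : ∀ x → 4 * x ≡ 4 * (1 * x)
  eqˡ = solve-∀
  eqʳ : ∀ y → 4 * y ≡ 2 * (2 * y)
  eqʳ = solve-∀
weight-step 3 M _ 3∤M
  rewrite dec-false (3 ∣? M) 3∤M | dec-true (3 ∣? (3 * M)) (m∣m*n M) =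
  subst₂ _≤_ (eqˡ (ifDivides 2 M 2 1)) (eqʳ (ifDivides 2 (3 * M) 2 1))
    (*-monoʳ-≤ 12 (ifDivides-mono 2 M (3 * M) (s≤s z≤n) (∣n⇒∣m*n 3)))
  where
  eqˡ : ∀ x → 12 * x ≡ 4 * (x * 3)
  eqˡ = solve-∀
  eqʳ : ∀ y → 12 * y ≡ 3 * (y * 4)
  eqʳ = solve-∀
weight-step p@(suc (suc (suc (suc _)))) M _ _ =
  *-mono-≤ {4} {p} (s≤s (s≤s (s≤s (s≤s z≤n))))
           (*-mono-≤ (ifDivides-mono 2 M (p * M) (s≤s z≤n) (∣n⇒∣m*n p))
                     (ifDivides-mono 3 M (p * M) (s≤s (s≤s (s≤s z≤n))) (∣n⇒∣m*n p)))

smallness-step : ∀ p {M F A B w w′} → F ≤ M →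
                 3 * ((A + B + M) * (A + B + M)) ≤ w * (M * M * M) → 4 * w ≤ p * w′ →
                 3 * ((p * (A + B) + p * (A + B + F) + p * M) * (p * (A + B) + p * (A + B + F) + p * M))
                   ≤ w′ * (p * M * (p * M) * (p * M))
smallness-step p {M} {F} {A} {B} {w} {w′} F≤M small 4w≤pw′ = begin
  3 * (S′ * S′)                        ≤⟨ *-monoʳ-≤ 3 (*-mono-≤ S′≤2pS S′≤2pS) ⟩
  3 * (2 * p * S * (2 * p * S))        ≡⟨ e₁ p S ⟩
  p * p * (4 * (3 * (S * S)))          ≤⟨ *-monoʳ-≤ (p * p) (*-monoʳ-≤ 4 small) ⟩
  p * p * (4 * (w * (M * M * M)))      ≡⟨ e₂ p w M ⟩
  p * p * (M * M * M) * (4 * w)        ≤⟨ *-monoʳ-≤ (p * p * (M * M * M)) 4w≤pw′ ⟩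
  p * p * (M * M * M) * (p * w′)       ≡⟨ e₃ p w′ M ⟩
  w′ * (p * M * (p * M) * (p * M))     ∎
  where
  open ≤-Reasoning
  S S′ : ℕ
  S = A + B + M
  S′ = p * (A + B) + p * (A + B + F) + p * M
  S′≤2pS : S′ ≤ 2 * p * S
  S′≤2pS = begin
    p * (A + B) + p * (A + B + F) + p * M  ≤⟨ +-monoˡ-≤ (p * M) (+-monoʳ-≤ (p * (A + B)) (*-monoʳ-≤ p (+-monoʳ-≤ (A + B) F≤M))) ⟩
    p * (A + B) + p * (A + B + M) + p * M  ≡⟨ e₀ p A B M ⟩
    2 * p * S                              ∎
    where
    e₀ : ∀ p A B M → p * (A + B) + p * (A + B + M) + p * M ≡ 2 * p * (A + B + M)
    e₀ = solve-∀
  e₁ : ∀ p S → 3 * (2 * p * S * (2 * p * S)) ≡ p * p * (4 * (3 * (S * S)))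
  e₁ = solve-∀
  e₂ : ∀ p w M → p * p * (4 * (w * (M * M * M))) ≡ p * p * (M * M * M) * (4 * w)
  e₂ = solve-∀
  e₃ : ∀ p w′ M → p * p * (M * M * M) * (p * w′) ≡ w′ * (p * M * (p * M) * (p * M))
  e₃ = solve-∀

-- In the estimates built below, M is the product of the primes dividing m and F = φ(M): integers
-- coprime to m have density F / M.
record CoprimeCountEstimate (m : ℕ) : Set where
  field
    M F A B        : ℕ
    M∣m            : M ∣ m
    F≤M            : F ≤ M
    count-multiple : ∀ a → coprimeCount m (M * a) ≡ F * a
    bounds         : LinearBounds (coprimeCount m) M F A B
    A≤B            : A ≤ B
    small          : 3 * ((A + B + M) * (A + B + M)) ≤ weight M * (M * M * M)

estimate-1 : CoprimeCountEstimate 1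
estimate-1 = record
  { M = 1 ; F = 1 ; A = 0 ; B = 0
  ; M∣m = ∣-refl
  ; F≤M = ≤-refl
  ; count-multiple = λ a → coprimeCount-1 (1 * a)
  ; bounds = record
    { upper = λ r → ≤-reflexive (trans (cong (1 *_) (coprimeCount-1 r)) (sym (+-identityʳ (1 * r))))
    ; lower = λ r → ≤-reflexive (trans (cong (1 *_) (sym (coprimeCount-1 r))) (sym (+-identityʳ _)))
    }
  ; A≤B = ≤-refl
  ; small = ≤-refl
  }

estimate-*-∣ : ∀ {p} → p ∣ k → CoprimeCountEstimate k → CoprimeCountEstimate (p * k)
estimate-*-∣ {k = k} {p = p} p∣k e = record
  { M = M ; F = F ; A = A ; B = B
  ; M∣m = ∣n⇒∣m*n p M∣m
  ; F≤M = F≤M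
  ; count-multiple = λ a → trans (same (M * a)) (count-multiple a)
  ; bounds = record
    { upper = λ r → subst (λ c → M * c ≤ F * r + B) (sym (same r)) (upper r)
    ; lower = λ r → subst (λ c → F * r ≤ M * c + A) (sym (same r)) (lower r)
    }
  ; A≤B = A≤B
  ; small = small
  }
  where
  open CoprimeCountEstimate e
  open LinearBounds bounds
  same : ∀ r → coprimeCount (p * k) r ≡ coprimeCount k r
  same = coprimeCount-*-∣ p∣k

estimate-*-∤ : ∀ {p} → Prime p → ¬ p ∣ k → CoprimeCountEstimate k → CoprimeCountEstimate (p * k)
estimate-*-∤ {k = k} {p = p@(suc p′)} pr p∤k e = record
  { M = p * M ; F = p′ * F ; A = p * (A + B) ; B = p * (A + B + F)
  ; M∣m = *-monoʳ-∣ p M∣m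
  ; F≤M = *-mono-≤ (n≤1+n p′) F≤M
  ; count-multiple = count-multiple′
  ; bounds = linearBounds-sieve p′ (coprimeCount-*-∤ pr p∤k) bounds
  ; A≤B = *-monoʳ-≤ p (m≤m+n (A + B) F)
  ; small = smallness-step p {M} {F} {A} {B} {weight M} {weight (p * M)} F≤M small (weight-step p M (nonTrivial⇒n>1 p {{prime⇒nonTrivial pr}}) (p∤k ∘ flip ∣-trans M∣m))
  }
  where
  open CoprimeCountEstimate e
  count-multiple′ : ∀ a → coprimeCount (p * k) (p * M * a) ≡ p′ * F * a
  count-multiple′ a = +-cancelʳ-≡ (F * a) _ _ (begin
    coprimeCount (p * k) (p * M * a) + F * a                        ≡⟨ cong₂ _+_ (cong (coprimeCount (p * k)) (e₁ p′ M a)) (count-multiple a) ⟨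
    coprimeCount (p * k) (0 + M * a * p) + coprimeCount k (M * a)   ≡⟨ coprimeCount-*-∤ pr p∤k (M * a) 0 (s≤s z≤n) ⟩
    coprimeCount k (0 + M * a * p)                                  ≡⟨ cong (coprimeCount k) (*-assoc M a p) ⟩
    coprimeCount k (M * (a * p))                                    ≡⟨ count-multiple (a * p) ⟩
    F * (a * p)                                                     ≡⟨ e₂ p′ F a ⟩
    p′ * F * a + F * a                                              ∎)
    where
    open ≡-Reasoning
    e₁ : ∀ p′ M a → M * a * suc p′ ≡ suc p′ * M * a
    e₁ = solve-∀
    e₂ : ∀ p′ F a → F * (a * suc p′) ≡ p′ * F * a + F * a
    e₂ = solve-∀

estimate-product : ∀ {ps} → All Prime ps → CoprimeCountEstimate (product ps)
estimate-product []                  = estimate-1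
estimate-product {p ∷ ps} (pr ∷ prs) with p ∣? product ps
... | yes p∣ = estimate-*-∣ p∣ (estimate-product prs)
... | no  p∤ = estimate-*-∤ pr p∤ (estimate-product prs)

estimate : ∀ m → .{{NonZero m}} → CoprimeCountEstimate m
estimate m = subst CoprimeCountEstimate (sym isFactorisation) (estimate-product factorsPrime)
  where open PrimeFactorisation (factorise m)

lowerError²<period³ : (e : CoprimeCountEstimate m) → let open CoprimeCountEstimate e in
                      .{{NonZero M}} → A * A < M * M * M
lowerError²<period³ e = *-cancelˡ-< 12 _ _ (begin-strict
  12 * (A * A)                         ≡⟨ e₁ A ⟩
  3 * ((A + A) * (A + A))              ≤⟨ *-monoʳ-≤ 3 (*-mono-≤ 2A≤S 2A≤S) ⟩
  3 * ((A + B + M) * (A + B + M))      ≤⟨ small ⟩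
  weight M * (M * M * M)               ≤⟨ *-monoˡ-≤ (M * M * M) (weight≤8 M) ⟩
  8 * (M * M * M)                      <⟨ *-monoˡ-< (M * M * M) {{m*n≢0 (M * M) M {{m*n≢0 M M}}}} {8} {12} (m<m+n 8 {4} z<s) ⟩
  12 * (M * M * M)                     ∎)
  where
  open CoprimeCountEstimate e
  open ≤-Reasoning
  2A≤S : A + A ≤ A + B + M
  2A≤S = ≤-trans (+-monoʳ-≤ A A≤B) (m≤m+n (A + B) M)
  e₁ : ∀ A → 12 * (A * A) ≡ 3 * ((A + A) * (A + A))
  e₁ = solve-∀

coprimeCount-deficit : (e : CoprimeCountEstimate m) → let open CoprimeCountEstimate e in
                       ∀ {d} → m ≡ d * M → ∀ n → φ m * n ≤ m * coprimeCount m n + d * A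
coprimeCount-deficit {m} e {d} m≡dM n = begin
  φ m * n                              ≡⟨ cong (λ x → coprimeCount m x * n) (trans m≡dM (*-comm d M)) ⟩
  coprimeCount m (M * d) * n           ≡⟨ cong (_* n) (count-multiple d) ⟩
  F * d * n                            ≡⟨ e₁ F d n ⟩
  d * (F * n)                          ≤⟨ *-monoʳ-≤ d (lower n) ⟩
  d * (M * coprimeCount m n + A)       ≡⟨ e₂ d M (coprimeCount m n) A ⟩
  d * M * coprimeCount m n + d * A     ≡⟨ cong (λ x → x * coprimeCount m n + d * A) m≡dM ⟨
  m * coprimeCount m n + d * A         ∎
  where
  open CoprimeCountEstimate e
  open LinearBounds bounds
  open ≤-Reasoning
  e₁ : ∀ F d n → F * d * n ≡ d * (F * n)
  e₁ = solve-∀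
  e₂ : ∀ d M C A → d * (M * C + A) ≡ d * M * C + d * A
  e₂ = solve-∀

corollary3p2 : (m n : ℕ) → 1 ≤ m → m ≤ n →
    GtFracMinusSqrt (coprimeCount m n) (φ m * n) m n
corollary3p2 m n 1≤m m≤n with estimate m {{>-nonZero 1≤m}}
... | e with CoprimeCountEstimate.M∣m e
...   | divides d m≡dM = begin-strict
  (φ m * n ∸ m * coprimeCount m n) ^ 2  ≤⟨ ^-monoˡ-≤ 2 deficit≤dA ⟩
  (d * A) ^ 2                           ≡⟨ e₁ d A ⟩
  d * d * (A * A)                       <⟨ *-monoʳ-< (d * d) {{m*n≢0 d d}} (lowerError²<period³ e) ⟩
  d * d * (M * M * M)                   ≤⟨ *-monoʳ-≤ (d * d) (*-monoʳ-≤ (M * M) M≤n) ⟩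
  d * d * (M * M * n)                   ≡⟨ e₂ d M n ⟩
  (d * M) ^ 2 * n                       ≡⟨ cong (λ x → x ^ 2 * n) m≡dM ⟨
  m ^ 2 * n                             ∎
  where
  open CoprimeCountEstimate e
  open ≤-Reasoning
  instance
    dM≢0 : NonZero (d * M)
    dM≢0 = subst NonZero m≡dM (>-nonZero 1≤m)
    d≢0 : NonZero d
    d≢0 = m*n≢0⇒m≢0 d
    M≢0 : NonZero M
    M≢0 = m*n≢0⇒n≢0 d
  deficit≤dA : φ m * n ∸ m * coprimeCount m n ≤ d * A
  deficit≤dA = m≤n+o⇒m∸n≤o (φ m * n) (m * coprimeCount m n) (coprimeCount-deficit e {d} m≡dM n)
  M≤n : M ≤ n
  M≤n = ≤-trans (∣⇒≤ {{>-nonZero 1≤m}} M∣m) m≤n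
  e₁ : ∀ d A → d * A * (d * A * 1) ≡ d * d * (A * A)
  e₁ = solve-∀
  e₂ : ∀ d M n → d * d * (M * M * n) ≡ d * M * (d * M * 1) * n
  e₂ = solve-∀
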